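{- Let $G$ be a graph of girth at least $5$ with $n$ vertices. Then $G$ contains at most $\sqrt{n}$ vertices of degree exceeding $\frac{3\sqrt n}{2}$, and the sum of the degrees of these vertices is at most $\frac{3n}{2}$.
   Context: Girth at least 5 means $G$ has no cycle of length 3 or 4. -}

module Defs where

open import Data.Bool using (Bool; T)
open import Data.Bool.Properties using (T?)
open import Data.Nat using (ℕ; _+_; _*_; _<_; _≤_)
open import Data.Fin using (Fin)
open import Data.List using (List; filter; allFin; length; map)
open import Data.Empty using (⊥)
open import Relation.Nullary using (¬_)
open import Relation.Binary.PropositionalEquality using (_≡_)

record Graph (n : ℕ) : Set where
  field
    adj   : Fin n → Fin n → Bool
    sym   : ∀ u v → T (adj u v) → T (adj v u)
    irrfl : ∀ v → ¬ T (adj v v)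

open Graph public

Adj : ∀ {n} → Graph n → Fin n → Fin n → Set
Adj G u v = T (adj G u v)

degree : ∀ {n} → Graph n → Fin n → ℕ
degree {n} G v = length (filter (λ u → T? (adj G v u)) (allFin n))

NoTriangle : ∀ {n} → Graph n → Set
NoTriangle G = ∀ a b c → ¬ a ≡ b → ¬ b ≡ c → ¬ a ≡ c →
  Adj G a b → Adj G b c → Adj G c a → ⊥

NoFourCycle : ∀ {n} → Graph n → Set
NoFourCycle G = ∀ a b c d →
  ¬ a ≡ b → ¬ a ≡ c → ¬ a ≡ d → ¬ b ≡ c → ¬ b ≡ d → ¬ c ≡ d →
  Adj G a b → Adj G b c → Adj G c d → Adj G d a → ⊥

GirthAtLeast5 : ∀ {n} → Graph n → Set
GirthAtLeast5 G = NoTriangle G × NoFourCycle G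
  where open import Data.Product using (_×_)

-- "deg v > 3√n/2"  ⟺  2·deg v > 3√n  ⟺  (2·deg v)² > 9n  (both sides ≥ 0).
HighDegree : ∀ {n} → Graph n → Fin n → Set
HighDegree {n} G v = 9 * n < (2 * degree G v) * (2 * degree G v)

HighDegree? : ∀ {n} (G : Graph n) v → Relation.Nullary.Dec (HighDegree G v)
HighDegree? {n} G v = 9 * n <? (2 * degree G v) * (2 * degree G v)
  where open import Data.Nat using (_<?_)

highVertices : ∀ {n} → Graph n → List (Fin n)
highVertices {n} G = filter (HighDegree? G) (allFin n)

{-# OPTIONS --safe #-}
module Submission where

open import Defs hiding (sym)

open import Data.Bool using (Bool; true; false; T; _∧_)
open import Data.Bool.Properties using (T?; T-∧)
open import Data.Empty using (⊥; ⊥-elim)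
open import Data.Fin using (Fin; zero; suc)
import Data.Fin.Properties as Fin
open import Data.List using (List; []; _∷_; length; map; filter; tabulate; allFin; take)
open import Data.List.Extrema.Nat using (argmin; argmin-all; f[argmin]≤f[⊤]; f[argmin]≤f[xs])
open import Data.List.Properties using (length-take)
open import Data.List.Relation.Unary.All using (All; []; _∷_)
import Data.List.Relation.Unary.All.Properties as All
open import Data.List.Relation.Unary.Unique.Propositional using (Unique; []; _∷_)
open import Data.List.Relation.Unary.Unique.Propositional.Properties
  using (allFin⁺; filter⁺; take⁺)
open import Data.Nat
  using (ℕ; zero; suc; _+_; _*_; _∸_; _≤_; _<_; z≤n; s≤s; s≤s⁻¹; _≤?_; _<?_)
open import Data.Nat.Combinatorics using (_C_; nC1≡n; nCk+nC[k+1]≡[n+1]C[k+1])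
open import Data.Nat.ListAction using (sum)
open import Data.Nat.Properties
open import Algebra.Properties.CommutativeMonoid.Sum +-0-commutativeMonoid
  using (sum-syntax; sum-cong-≗; sum-replicate-zero; ∑-distrib-+)
open import Data.Nat.Tactic.RingSolver using (solve-∀)
open import Data.Product using (_×_; _,_; ∃-syntax)
open import Function using (_∘_; id; Equivalence)
open import Relation.Binary.PropositionalEquality
  using (_≡_; _≢_; refl; sym; trans; cong; cong₂; subst; module ≡-Reasoning)
open import Relation.Nullary using (yes; no)
open import Relation.Nullary.Decidable using (decidable-stable)

-- Two distinct vertices of a graph without 4-cycles have at most one common neighbour.  If a vertex
-- w has c neighbours among distinct vertices v₁ … vₘ, then c ≤ 1 + (c choose 2); summing over w,
-- each pair vᵢ, vⱼ is counted at most once, so deg v₁ + … + deg vₘ ≤ n + (m choose 2).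
-- If more than √n vertices had degree > 3√n/2, then m = ⌊√n⌋ + 1 of them would have degree sum
-- > 3m√n/2 ≥ n + (m choose 2).  Hence there are at most √n of them, and the same bound then gives
-- them degree sum at most n + n/2.

m*m<n*n⇒m<n : ∀ {m n} → m * m < n * n → m < n
m*m<n*n⇒m<n m²<n² = ≰⇒> (λ n≤m → <⇒≱ m²<n² (*-mono-≤ n≤m n≤m))

floor-sqrt : ∀ n → ∃[ s ] s * s ≤ n × n < suc s * suc s
floor-sqrt zero = 0 , z≤n , s≤s z≤n
floor-sqrt (suc n) with floor-sqrt n
... | s , s²≤n , n<[1+s]² with suc n <? suc s * suc s
...   | yes 1+n<[1+s]² = s , m≤n⇒m≤1+n s²≤n , 1+n<[1+s]²
...   | no 1+n≮[1+s]² =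
  suc s , ≮⇒≥ 1+n≮[1+s]² , ≤-<-trans n<[1+s]² (*-mono-< (n<1+n (suc s)) (n<1+n (suc s)))

[1+m]C2≡m+mC2 : ∀ m → suc m C 2 ≡ m + m C 2
[1+m]C2≡m+mC2 m = begin
  suc m C 2      ≡⟨ nCk+nC[k+1]≡[n+1]C[k+1] m 1 ⟨
  m C 1 + m C 2  ≡⟨ cong (_+ m C 2) (nC1≡n m) ⟩
  m + m C 2      ∎
  where open ≡-Reasoning

[1+m]²≡1+m²+2m : ∀ m → suc m * suc m ≡ suc (m * m + 2 * m)
[1+m]²≡1+m²+2m = solve-∀

2*mC2+m≡m*m : ∀ m → 2 * (m C 2) + m ≡ m * m
2*mC2+m≡m*m zero = refl
2*mC2+m≡m*m (suc m) = begin
  2 * (suc m C 2) + suc m          ≡⟨ cong (λ c → 2 * c + suc m) ([1+m]C2≡m+mC2 m) ⟩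
  2 * (m + m C 2) + suc m          ≡⟨ regroup m (m C 2) ⟩
  suc (2 * (m C 2) + m + 2 * m)    ≡⟨ cong (λ x → suc (x + 2 * m)) (2*mC2+m≡m*m m) ⟩
  suc (m * m + 2 * m)              ≡⟨ [1+m]²≡1+m²+2m m ⟨
  suc m * suc m                    ∎
  where
  open ≡-Reasoning
  regroup : ∀ m p → 2 * (m + p) + suc m ≡ suc (2 * p + m + 2 * m)
  regroup = solve-∀

2*[1+s]C2≡[1+s]*s : ∀ s → 2 * (suc s C 2) ≡ suc s * s
2*[1+s]C2≡[1+s]*s s = +-cancelʳ-≡ (suc s) _ _ (begin
  2 * (suc s C 2) + suc s  ≡⟨ 2*mC2+m≡m*m (suc s) ⟩
  suc s * suc s            ≡⟨ *-suc (suc s) s ⟩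
  suc s + suc s * s        ≡⟨ +-comm (suc s) _ ⟩
  suc s * s + suc s        ∎)
  where open ≡-Reasoning

[2n+[1+s]s]²≤9n[1+s]² : ∀ s n → s * s ≤ n → n < suc s * suc s →
  (2 * n + suc s * s) * (2 * n + suc s * s) ≤ 9 * n * (suc s * suc s)
[2n+[1+s]s]²≤9n[1+s]² s n s²≤n n<[1+s]² = subst
  (λ n → (2 * n + suc s * s) * (2 * n + suc s * s) ≤ 9 * n * (suc s * suc s))
  (m+[n∸m]≡n s²≤n) (bound (n ∸ s * s) r≤2s)
  where
  r≤2s : n ∸ s * s ≤ 2 * s
  r≤2s = +-cancelˡ-≤ (s * s) _ _ (s≤s⁻¹ (begin
    suc (s * s + (n ∸ s * s))  ≡⟨ cong suc (m+[n∸m]≡n s²≤n) ⟩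
    suc n                      ≤⟨ n<[1+s]² ⟩
    suc s * suc s              ≡⟨ [1+m]²≡1+m²+2m s ⟩
    suc (s * s + 2 * s)        ∎))
    where open ≤-Reasoning
  -- With n = s² + r, the slack 9n(s+1)² − (2n + (s+1)s)² is
  -- (3s² + 4r)(2s − r) + 6s³ + 8s² + 6rs + 9r.
  bound : ∀ r → r ≤ 2 * s →
    (2 * (s * s + r) + suc s * s) * (2 * (s * s + r) + suc s * s) ≤ 9 * (s * s + r) * (suc s * suc s)
  bound r r≤2s = +-cancelʳ-≤ ((3 * (s * s) + 4 * r) * (2 * s)) _ _ (begin
    L² + (3 * (s * s) + 4 * r) * (2 * s)
      ≤⟨ m≤m+n _ (6 * (s * s * s) + 8 * (s * s) + 6 * r * s + 9 * r) ⟩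
    L² + (3 * (s * s) + 4 * r) * (2 * s) + (6 * (s * s * s) + 8 * (s * s) + 6 * r * s + 9 * r)
      ≡⟨ expand s r ⟩
    9 * (s * s + r) * (suc s * suc s) + (3 * (s * s) + 4 * r) * r
      ≤⟨ +-monoʳ-≤ _ (*-monoʳ-≤ (3 * (s * s) + 4 * r) r≤2s) ⟩
    9 * (s * s + r) * (suc s * suc s) + (3 * (s * s) + 4 * r) * (2 * s)
      ∎)
    where
    open ≤-Reasoning
    L² = (2 * (s * s + r) + suc s * s) * (2 * (s * s + r) + suc s * s)
    expand : ∀ s r →
      (2 * (s * s + r) + suc s * s) * (2 * (s * s + r) + suc s * s) + (3 * (s * s) + 4 * r) * (2 * s)
        + (6 * (s * s * s) + 8 * (s * s) + 6 * r * s + 9 * r)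
      ≡ 9 * (s * s + r) * (suc s * suc s) + (3 * (s * s) + 4 * r) * r
    expand = solve-∀

n+[1+s]C2<[1+s]*t : ∀ s n t → s * s ≤ n → n < suc s * suc s → 9 * n < 2 * t * (2 * t) →
  n + suc s C 2 < suc s * t
n+[1+s]C2<[1+s]*t s n t s²≤n n<[1+s]² 9n<[2t]² = *-cancelˡ-< 2 _ _ (m*m<n*n⇒m<n (begin-strict
  2 * (n + m C 2) * (2 * (n + m C 2))  ≡⟨ cong (λ x → x * x) double ⟩
  (2 * n + m * s) * (2 * n + m * s)    ≤⟨ [2n+[1+s]s]²≤9n[1+s]² s n s²≤n n<[1+s]² ⟩
  9 * n * (m * m)                      <⟨ *-monoˡ-< (m * m) 9n<[2t]² ⟩
  2 * t * (2 * t) * (m * m)            ≡⟨ regroup t m ⟩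
  2 * (m * t) * (2 * (m * t))          ∎))
  where
  open ≤-Reasoning
  m = suc s
  double : 2 * (n + m C 2) ≡ 2 * n + m * s
  double = trans (*-distribˡ-+ 2 n (m C 2)) (cong (2 * n +_) (2*[1+s]C2≡[1+s]*s s))
  regroup : ∀ t m → 2 * t * (2 * t) * (m * m) ≡ 2 * (m * t) * (2 * (m * t))
  regroup = solve-∀

length*t≤sum : ∀ {A : Set} (f : A → ℕ) {t} xs → All (λ x → t ≤ f x) xs →
  length xs * t ≤ sum (map f xs)
length*t≤sum f []       []         = z≤n
length*t≤sum f (x ∷ xs) (t≤ ∷ t≤s) = +-mono-≤ t≤ (length*t≤sum f xs t≤s)

𝟙 : Bool → ℕ
𝟙 true  = 1
𝟙 false = 0

𝟙-∧ : ∀ x y → 𝟙 (x ∧ y) ≡ 𝟙 x * 𝟙 y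
𝟙-∧ true  y = sym (+-identityʳ (𝟙 y))
𝟙-∧ false y = refl

length-filter-tabulate : ∀ {A : Set} {n} (p : A → Bool) (f : Fin n → A) →
  length (filter (T? ∘ p) (tabulate f)) ≡ ∑[ i < n ] 𝟙 (p (f i))
length-filter-tabulate {n = zero}  p f = refl
length-filter-tabulate {n = suc n} p f with p (f zero)
... | true  = cong suc (length-filter-tabulate p (f ∘ suc))
... | false = length-filter-tabulate p (f ∘ suc)

∑-mono-≤ : ∀ {n} {f g : Fin n → ℕ} → (∀ i → f i ≤ g i) → ∑[ i < n ] f i ≤ ∑[ i < n ] g i
∑-mono-≤ {zero}  f≤g = z≤n
∑-mono-≤ {suc n} f≤g = +-mono-≤ (f≤g zero) (∑-mono-≤ (f≤g ∘ suc))

∑[1]≡n : ∀ n → ∑[ i < n ] 1 ≡ n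
∑[1]≡n zero    = refl
∑[1]≡n (suc n) = cong suc (∑[1]≡n n)

∑𝟙≡0 : ∀ {n} (p : Fin n → Bool) → (∀ i → p i ≡ false) → ∑[ i < n ] 𝟙 (p i) ≡ 0
∑𝟙≡0 {zero}  p p≡false = refl
∑𝟙≡0 {suc n} p p≡false rewrite p≡false zero = ∑𝟙≡0 (p ∘ suc) (p≡false ∘ suc)

∑𝟙≤1 : ∀ {n} (p : Fin n → Bool) → (∀ i j → T (p i) → T (p j) → i ≡ j) →
  ∑[ i < n ] 𝟙 (p i) ≤ 1
∑𝟙≤1 {zero}  p unique = z≤n
∑𝟙≤1 {suc n} p unique with p zero in p₀
... | false = ∑𝟙≤1 (p ∘ suc) (λ i j pi pj → Fin.suc-injective (unique (suc i) (suc j) pi pj))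
... | true  = s≤s (≤-reflexive (∑𝟙≡0 (p ∘ suc) elsewhere))
  where
  elsewhere : ∀ i → p (suc i) ≡ false
  elsewhere i with p (suc i) in pᵢ
  ... | false = refl
  ... | true  with () ← unique zero (suc i) (subst T (sym p₀) _) (subst T (sym pᵢ) _)

module _ {n : ℕ} (G : Graph n) where

  adj⇒≢ : ∀ {u v} → Adj G u v → u ≢ v
  adj⇒≢ {u} uv refl = irrfl G u uv

  degree≡∑ : ∀ v → degree G v ≡ ∑[ w < n ] 𝟙 (adj G v w)
  degree≡∑ v = length-filter-tabulate (adj G v) id

  neighboursIn : List (Fin n) → Fin n → ℕ
  neighboursIn L w = sum (map (λ v → 𝟙 (adj G v w)) L)

  neighbourPairsIn : List (Fin n) → Fin n → ℕ
  neighbourPairsIn []      w = 0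
  neighbourPairsIn (v ∷ L) w = 𝟙 (adj G v w) * neighboursIn L w + neighbourPairsIn L w

  sum-degree≡∑-neighboursIn : ∀ L → sum (map (degree G) L) ≡ ∑[ w < n ] neighboursIn L w
  sum-degree≡∑-neighboursIn []      = sym (sum-replicate-zero n)
  sum-degree≡∑-neighboursIn (v ∷ L) =
    trans (cong₂ _+_ (degree≡∑ v) (sum-degree≡∑-neighboursIn L))
          (sym (∑-distrib-+ (λ w → 𝟙 (adj G v w)) (neighboursIn L)))

  neighboursIn≤1+neighbourPairsIn : ∀ L w → neighboursIn L w ≤ 1 + neighbourPairsIn L w
  neighboursIn≤1+neighbourPairsIn []      w = z≤n
  neighboursIn≤1+neighbourPairsIn (v ∷ L) w with adj G v w
  ... | true  = s≤s (subst (λ c → neighboursIn L w ≤ c + neighbourPairsIn L w)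
                         (sym (*-identityˡ (neighboursIn L w))) (m≤m+n _ _))
  ... | false = neighboursIn≤1+neighbourPairsIn L w

  module _ (no4 : NoFourCycle G) where

    commonNeighbour-unique : ∀ {u v w₁ w₂} → u ≢ v →
      Adj G u w₁ → Adj G v w₁ → Adj G u w₂ → Adj G v w₂ → w₁ ≡ w₂
    commonNeighbour-unique {u} {v} {w₁} {w₂} u≢v uw₁ vw₁ uw₂ vw₂ =
      decidable-stable (w₁ Fin.≟ w₂) λ w₁≢w₂ →
        no4 u w₁ v w₂ (adj⇒≢ uw₁) u≢v (adj⇒≢ uw₂) (adj⇒≢ w₁v) w₁≢w₂ (adj⇒≢ vw₂)
            uw₁ w₁v vw₂ w₂u
      where
      w₁v = Graph.sym G v w₁ vw₁
      w₂u = Graph.sym G u w₂ uw₂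

    ∑-commonNeighbours≤1 : ∀ {u v} → u ≢ v → ∑[ w < n ] (𝟙 (adj G u w) * 𝟙 (adj G v w)) ≤ 1
    ∑-commonNeighbours≤1 {u} {v} u≢v = begin
      ∑[ w < n ] (𝟙 (adj G u w) * 𝟙 (adj G v w))
        ≡⟨ sum-cong-≗ (λ w → sym (𝟙-∧ (adj G u w) (adj G v w))) ⟩
      ∑[ w < n ] 𝟙 (adj G u w ∧ adj G v w)
        ≤⟨ ∑𝟙≤1 _ unique ⟩
      1 ∎
      where
      open ≤-Reasoning
      unique : ∀ w₁ w₂ → T (adj G u w₁ ∧ adj G v w₁) → T (adj G u w₂ ∧ adj G v w₂) →
        w₁ ≡ w₂
      unique w₁ w₂ uvw₁ uvw₂
        with (uw₁ , vw₁) ← Equivalence.to T-∧ uvw₁ | (uw₂ , vw₂) ← Equivalence.to T-∧ uvw₂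
        = commonNeighbour-unique u≢v uw₁ vw₁ uw₂ vw₂

    ∑-commonNeighboursWith≤length : ∀ v L → All (v ≢_) L →
      ∑[ w < n ] (𝟙 (adj G v w) * neighboursIn L w) ≤ length L
    ∑-commonNeighboursWith≤length v [] [] = ≤-reflexive (begin
      ∑[ w < n ] (𝟙 (adj G v w) * 0) ≡⟨ sum-cong-≗ (λ w → *-zeroʳ (𝟙 (adj G v w))) ⟩
      ∑[ w < n ] 0                  ≡⟨ sum-replicate-zero n ⟩
      0                             ∎)
      where open ≡-Reasoning
    ∑-commonNeighboursWith≤length v (u ∷ L) (v≢u ∷ v∉L) = begin
      ∑[ w < n ] (𝟙 (adj G v w) * (𝟙 (adj G u w) + neighboursIn L w))
        ≡⟨ sum-cong-≗ (λ w → *-distribˡ-+ (𝟙 (adj G v w)) _ _) ⟩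
      ∑[ w < n ] (𝟙 (adj G v w) * 𝟙 (adj G u w) + 𝟙 (adj G v w) * neighboursIn L w)
        ≡⟨ ∑-distrib-+ (λ w → 𝟙 (adj G v w) * 𝟙 (adj G u w))
                       (λ w → 𝟙 (adj G v w) * neighboursIn L w) ⟩
      ∑[ w < n ] (𝟙 (adj G v w) * 𝟙 (adj G u w))
        + ∑[ w < n ] (𝟙 (adj G v w) * neighboursIn L w)
        ≤⟨ +-mono-≤ (∑-commonNeighbours≤1 v≢u) (∑-commonNeighboursWith≤length v L v∉L) ⟩
      suc (length L)
        ∎
      where open ≤-Reasoning

    ∑-neighbourPairsIn≤C2 : ∀ L → Unique L → ∑[ w < n ] neighbourPairsIn L w ≤ length L C 2
    ∑-neighbourPairsIn≤C2 []      []           = ≤-reflexive (sum-replicate-zero n)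
    ∑-neighbourPairsIn≤C2 (v ∷ L) (v∉L ∷ uniq) = begin
      ∑[ w < n ] (𝟙 (adj G v w) * neighboursIn L w + neighbourPairsIn L w)
        ≡⟨ ∑-distrib-+ (λ w → 𝟙 (adj G v w) * neighboursIn L w) (neighbourPairsIn L) ⟩
      ∑[ w < n ] (𝟙 (adj G v w) * neighboursIn L w) + ∑[ w < n ] neighbourPairsIn L w
        ≤⟨ +-mono-≤ (∑-commonNeighboursWith≤length v L v∉L) (∑-neighbourPairsIn≤C2 L uniq) ⟩
      length L + length L C 2
        ≡⟨ sym ([1+m]C2≡m+mC2 (length L)) ⟩
      suc (length L) C 2
        ∎
      where open ≤-Reasoning

    sum-degree≤n+C2 : ∀ L → Unique L → sum (map (degree G) L) ≤ n + length L C 2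
    sum-degree≤n+C2 L uniq = begin
      sum (map (degree G) L)
        ≡⟨ sum-degree≡∑-neighboursIn L ⟩
      ∑[ w < n ] neighboursIn L w
        ≤⟨ ∑-mono-≤ (neighboursIn≤1+neighbourPairsIn L) ⟩
      ∑[ w < n ] (1 + neighbourPairsIn L w)
        ≡⟨ ∑-distrib-+ (λ _ → 1) (neighbourPairsIn L) ⟩
      ∑[ w < n ] 1 + ∑[ w < n ] neighbourPairsIn L w
        ≤⟨ +-mono-≤ (≤-reflexive (∑[1]≡n n)) (∑-neighbourPairsIn≤C2 L uniq) ⟩
      n + length L C 2
        ∎
      where open ≤-Reasoning

    no-[1+√n]-highDegree : ∀ {s} → s * s ≤ n → n < suc s * suc s →
      ∀ L → length L ≡ suc s → Unique L → All (HighDegree G) L → ⊥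
    no-[1+√n]-highDegree {s} s²≤n n<[1+s]² (v ∷ L) refl uniq (v-high ∷ L-high) =
      <⇒≱ (n+[1+s]C2<[1+s]*t s n t s²≤n n<[1+s]² t-high) (begin
        suc s * t                       ≤⟨ length*t≤sum (degree G) (v ∷ L) t≤ ⟩
        sum (map (degree G) (v ∷ L))    ≤⟨ sum-degree≤n+C2 (v ∷ L) uniq ⟩
        n + suc s C 2                   ∎)
      where
      open ≤-Reasoning
      t = degree G (argmin (degree G) v L)
      t-high : HighDegree G (argmin (degree G) v L)
      t-high = argmin-all (degree G) v-high L-high
      t≤ : All (λ x → t ≤ degree G x) (v ∷ L)
      t≤ = f[argmin]≤f[⊤] {f = degree G} v L ∷ f[argmin]≤f[xs] {f = degree G} v L

    highDegree-length²≤n : ∀ L → Unique L → All (HighDegree G) L → length L * length L ≤ n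
    highDegree-length²≤n L uniq high with length L * length L ≤? n | floor-sqrt n
    ... | yes L²≤n | _                     = L²≤n
    ... | no L²≰n  | s , s²≤n , n<[1+s]² =
      ⊥-elim (no-[1+√n]-highDegree s²≤n n<[1+s]² (take (suc s) L) length-prefix
        (take⁺ (suc s) uniq) (All.take⁺ (suc s) high))
      where
      length-prefix : length (take (suc s) L) ≡ suc s
      length-prefix = trans (length-take (suc s) L)
                            (m≤n⇒m⊓n≡m (m*m<n*n⇒m<n (≤-<-trans s²≤n (≰⇒> L²≰n))))

    highDegree-2*sum-degree≤3n : ∀ L → Unique L → All (HighDegree G) L →
      2 * sum (map (degree G) L) ≤ 3 * n
    highDegree-2*sum-degree≤3n L uniq high = begin
      2 * sum (map (degree G) L)  ≤⟨ *-monoʳ-≤ 2 (sum-degree≤n+C2 L uniq) ⟩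
      2 * (n + k C 2)             ≡⟨ *-distribˡ-+ 2 n (k C 2) ⟩
      2 * n + 2 * (k C 2)         ≤⟨ +-monoʳ-≤ (2 * n) 2*kC2≤k*k ⟩
      2 * n + k * k               ≤⟨ +-monoʳ-≤ (2 * n) (highDegree-length²≤n L uniq high) ⟩
      2 * n + n                   ≡⟨ +-comm (2 * n) n ⟩
      3 * n                       ∎
      where
      open ≤-Reasoning
      k = length L
      2*kC2≤k*k : 2 * (k C 2) ≤ k * k
      2*kC2≤k*k = subst (2 * (k C 2) ≤_) (2*mC2+m≡m*m k) (m≤m+n _ k)

mainTheorem13 : (n : ℕ) (G : Graph n) → GirthAtLeast5 G →
    (length (highVertices G) * length (highVertices G) ≤ n)
    × (2 * sum (map (degree G) (highVertices G)) ≤ 3 * n)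
mainTheorem13 n G (_ , no4) =
  highDegree-length²≤n G no4 H distinct high , highDegree-2*sum-degree≤3n G no4 H distinct high
  where
  H = highVertices G
  distinct : Unique H
  distinct = filter⁺ (HighDegree? G) (allFin⁺ n)
  high : All (HighDegree G) H
  high = All.all-filter (HighDegree? G) (allFin n)
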